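{- Let $\Sigma$ be a set of $\mathcal{L}^+$-sentences, $\Gamma$ a finite set of $\mathcal{L}^+$-sentences and $\phi$ an $\mathcal{L}^+$-sentence. If $\Sigma\cup\Gamma\vdash_\Sigma\phi$ then $\Sigma\vdash\bigwedge\Gamma\rightarrow\phi$ (where $\bigwedge\emptyset=\top$).
   Context: Let $\mathcal{L}$ be a first-order language whose formulas are built from atomic formulas, $\top$ and $\bot$ using exactly $\wedge,\vee,\rightarrow,\forall,\exists$, and let $\mathcal{L}^+=\mathcal{L}\cup\{a_i\}_{i\in\omega}$ with the $a_i$ fresh constant symbols. $\bigwedge\Gamma$ denotes the conjunction of the members of the finite set $\Gamma$. The natural deduction system $\mathcal{N}\mathsf{BQL}_{\mathsf{CD}}$ consists of trees of (possibly discharged) $\mathcal{L}^+$-sentences built with the following rules, where all displayed formulas are sentences (so e.g. in CD, $v$ is not free in $\phi$), $t$ ranges over closed $\mathcal{L}^+$-terms, and $\phi(t)$ denotes substitution for the free variable $v$: ($\top$-Int) $\top$ may be placed at a leaf as an already-discharged assumption; ($\bot$-Elim) from $\bot$ infer $\phi$; ($\wedge$-Int) from $\phi,\psi$ infer $\phi\wedge\psi$; ($\wedge$-Elim) from $\phi\wedge\psi$ infer $\phi$, or infer $\psi$; ($\vee$-Int) from $\phi$ or from $\psi$ infer $\phi\vee\psi$; ($\vee$-Elim) from $\phi\vee\psi$, a derivation of $\chi$ from assumption $\phi$ and a derivation of $\chi$ from assumption $\psi$, infer $\chi$, discharging those assumptions; ($\rightarrow$-Int) from a derivation of $\psi$ from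 assumption $\phi$ infer $\phi\rightarrow\psi$, discharging $\phi$; (Internal Transitivity) from $\phi\rightarrow\psi$ and $\psi\rightarrow\chi$ infer $\phi\rightarrow\chi$; (Internal $\wedge$-Int) from $\phi\rightarrow\psi$ and $\phi\rightarrow\chi$ infer $\phi\rightarrow\psi\wedge\chi$; (Internal $\vee$-Elim) from $\phi\rightarrow\chi$ and $\psi\rightarrow\chi$ infer $\phi\vee\psi\rightarrow\chi$; (Internal $\forall$-Int) from $\forall v(\phi\rightarrow\psi)$ infer $\phi\rightarrow\forall v\psi$; (Internal $\exists$-Elim) from $\forall v(\phi\rightarrow\psi)$ infer $\exists v\phi\rightarrow\psi$; ($\forall$-Int) from $\phi(a_i)$ infer $\forall v\phi$, provided $a_i$ occurs neither in $\phi$ nor in any open assumption of the derivation of $\phi(a_i)$; ($\forall$-Elim) from $\forall v\phi$ infer $\phi(t)$; (CD) from $\forall v(\phi\vee\psi)$ infer $\phi\vee\forall v\psi$; ($\exists$-Int) from $\phi(t)$ infer $\exists v\phi$; ($\exists$-Elim) from $\exists v\phi$ and a derivation of $\psi$ from assumption $\phi(a_i)$ infer $\psi$, discharging $\phi(a_i)$, provided $a_i$ occurs neither in $\phi$, nor in $\psi$, nor in any open assumption other than $\phi(a_i)$ of that derivation. There is no modus ponens rule. $\Gamma\vdash\phi$ means there is such a tree with root $\phi$ all of whose open assumptions lie in $\Gamma$. For a set $\Sigma$ of $\mathcal{L}^+$-sentences, $\mathcal{N}\mathsf{BQL}_{\mathsf{CD}}(\Sigma)$ is obtained from $\mathcal{N}\mathsf{BQL}_{\mathsf{CD}}$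 by adding the rule: from $\phi$ and $\phi\rightarrow\psi$ infer $\psi$, where the premise $\phi\rightarrow\psi$ must be the conclusion of a derivation in $\mathcal{N}\mathsf{BQL}_{\mathsf{CD}}$ from assumptions in $\Sigma$. An occurrence of an open assumption lying in such a derivation of the premise $\phi\rightarrow\psi$ of an application of this new rule is called unsafe. The system imposes the restrictions: (i) no unsafe occurrence of an assumption can be discharged; (ii) in $\exists$-Elim, no occurrence of the assumption $\phi(a_i)$ in the derivation of the minor premise may be unsafe. $\Delta\vdash_\Sigma\phi$ means there is a proof of $\phi$ in $\mathcal{N}\mathsf{BQL}_{\mathsf{CD}}(\Sigma)$ all of whose open assumptions lie in $\Delta$. -}

module Defs where

open import Data.Nat using (ℕ; zero; suc; _≤_)
open import Data.Fin using (Fin; zero; suc; inject₁)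
open import Data.Vec using (Vec; []; _∷_)
open import Data.List using (List; []; _∷_)
open import Data.Maybe using (Maybe; just; nothing; maybe)
open import Data.Product using (Σ; Σ-syntax; _×_; ∃)
open import Data.Sum using (_⊎_)
open import Data.Empty using (⊥)
import Data.Unit
open import Relation.Nullary using (¬_)
open import Relation.Binary.PropositionalEquality using (_≡_)

record Signature : Set₁ where
  field
    Fun   : Set
    funAr : Fun → ℕ
    Rel   : Set
    relAr : Rel → ℕ

module FOL (L : Signature) where
  open Signature L

  -- L⁺-terms and formulas with n bound variables in scope (de Bruijn).
  -- A binder introduces variable 'zero'; the outermost bound variable of
  -- a Form (suc n) is therefore the maximal index.  'par i' is the fresh
  -- constant a_i.

  data Term (n : ℕ) : Set where
    var : Fin n → Term n
    par : ℕ → Term n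
    fn  : (f : Fun) → Vec (Term n) (funAr f) → Term n

  infixr 6 _∧̇_
  infixr 5 _∨̇_
  infixr 4 _⇒_

  data Form (n : ℕ) : Set where
    atom : (R : Rel) → Vec (Term n) (relAr R) → Form n
    ⊤̇ ⊥̇ : Form n
    _∧̇_ _∨̇_ _⇒_ : Form n → Form n → Form n
    ∀̇ ∃̇ : Form (suc n) → Form n

  Sent : Set
  Sent = Form 0

  mutual
    wkT : ∀ {n} → Term n → Term (suc n)
    wkT (var i)   = var (inject₁ i)
    wkT (par j)   = par j
    wkT (fn f ts) = fn f (wkTs ts)

    wkTs : ∀ {n k} → Vec (Term n) k → Vec (Term (suc n)) k
    wkTs []       = []
    wkTs (t ∷ ts) = wkT t ∷ wkTs ts

  embed : ∀ {n} → Form n → Form (suc n)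
  embed (atom R ts) = atom R (wkTs ts)
  embed ⊤̇ = ⊤̇
  embed ⊥̇ = ⊥̇
  embed (φ ∧̇ ψ) = embed φ ∧̇ embed ψ
  embed (φ ∨̇ ψ) = embed φ ∨̇ embed ψ
  embed (φ ⇒ ψ) = embed φ ⇒ embed ψ
  embed (∀̇ φ) = ∀̇ (embed φ)
  embed (∃̇ φ) = ∃̇ (embed φ)

  mutual
    closeT : ∀ {n} → Term 0 → Term n
    closeT (var ())
    closeT (par j)   = par j
    closeT (fn f ts) = fn f (closeTs ts)

    closeTs : ∀ {n k} → Vec (Term 0) k → Vec (Term n) k
    closeTs []       = []
    closeTs (t ∷ ts) = closeT t ∷ closeTs ts

  split : ∀ {n} → Fin (suc n) → Maybe (Fin n)
  split {zero}  zero    = nothing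
  split {suc n} zero    = just zero
  split {suc n} (suc i) = Data.Maybe.map suc (split i)

  -- substitution of a closed term for the outermost variable
  mutual
    substT : ∀ {n} → Term 0 → Term (suc n) → Term n
    substT t (var i)   = maybe var (closeT t) (split i)
    substT t (par j)   = par j
    substT t (fn f ts) = fn f (substTs t ts)

    substTs : ∀ {n k} → Term 0 → Vec (Term (suc n)) k → Vec (Term n) k
    substTs t []       = []
    substTs t (u ∷ us) = substT t u ∷ substTs t us

  substF : ∀ {n} → Term 0 → Form (suc n) → Form n
  substF t (atom R ts) = atom R (substTs t ts)
  substF t ⊤̇ = ⊤̇
  substF t ⊥̇ = ⊥̇
  substF t (φ ∧̇ ψ) = substF t φ ∧̇ substF t ψ
  substF t (φ ∨̇ ψ) = substF t φ ∨̇ substF t ψ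
  substF t (φ ⇒ ψ) = substF t φ ⇒ substF t ψ
  substF t (∀̇ φ) = ∀̇ (substF t φ)
  substF t (∃̇ φ) = ∃̇ (substF t φ)

  _[_] : Form 1 → Term 0 → Sent
  φ [ t ] = substF t φ

  mutual
    OccT : ∀ {n} → ℕ → Term n → Set
    OccT i (var _)   = ⊥
    OccT i (par j)   = i ≡ j
    OccT i (fn f ts) = OccTs i ts

    OccTs : ∀ {n k} → ℕ → Vec (Term n) k → Set
    OccTs i []       = ⊥
    OccTs i (t ∷ ts) = OccT i t ⊎ OccTs i ts

  OccF : ∀ {n} → ℕ → Form n → Set
  OccF i (atom R ts) = OccTs i ts
  OccF i ⊤̇ = ⊥
  OccF i ⊥̇ = ⊥
  OccF i (φ ∧̇ ψ) = OccF i φ ⊎ OccF i ψ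
  OccF i (φ ∨̇ ψ) = OccF i φ ⊎ OccF i ψ
  OccF i (φ ⇒ ψ) = OccF i φ ⊎ OccF i ψ
  OccF i (∀̇ φ) = OccF i φ
  OccF i (∃̇ φ) = OccF i φ

  ⋀ : List Sent → Sent
  ⋀ []           = ⊤̇
  ⋀ (φ ∷ [])     = φ
  ⋀ (φ ∷ ψ ∷ Γ)  = φ ∧̇ ⋀ (ψ ∷ Γ)

  -- Raw derivation trees.  Δ lists the assumption slots of discharging
  -- rules below the current node (innermost first).  A leaf is either an
  -- open assumption 'hyp φ', or an assumption 'dis x' that is discharged
  -- by the rule owning slot x, or the (already discharged) ⊤.

  data _∋_ : List Sent → Sent → Set where
    here  : ∀ {Δ φ} → (φ ∷ Δ) ∋ φ
    there : ∀ {Δ φ ψ} → Δ ∋ φ → (ψ ∷ Δ) ∋ φ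

  pos : ∀ {Δ φ} → Δ ∋ φ → ℕ
  pos here      = zero
  pos (there x) = suc (pos x)

  data Tree (Δ : List Sent) : Sent → Set where
    hyp    : (φ : Sent) → Tree Δ φ
    dis    : ∀ {φ} → Δ ∋ φ → Tree Δ φ
    ⊤I     : Tree Δ ⊤̇
    ⊥E     : (φ : Sent) → Tree Δ ⊥̇ → Tree Δ φ
    ∧I     : ∀ {φ ψ} → Tree Δ φ → Tree Δ ψ → Tree Δ (φ ∧̇ ψ)
    ∧E₁    : ∀ {φ ψ} → Tree Δ (φ ∧̇ ψ) → Tree Δ φ
    ∧E₂    : ∀ {φ ψ} → Tree Δ (φ ∧̇ ψ) → Tree Δ ψ
    ∨I₁    : ∀ {φ} (ψ : Sent) → Tree Δ φ → Tree Δ (φ ∨̇ ψ)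
    ∨I₂    : (φ : Sent) → ∀ {ψ} → Tree Δ ψ → Tree Δ (φ ∨̇ ψ)
    ∨E     : ∀ {φ ψ χ} → Tree Δ (φ ∨̇ ψ) → Tree (φ ∷ Δ) χ → Tree (ψ ∷ Δ) χ → Tree Δ χ
    ⇒I     : ∀ {φ ψ} → Tree (φ ∷ Δ) ψ → Tree Δ (φ ⇒ ψ)
    iTrans : ∀ {φ ψ χ} → Tree Δ (φ ⇒ ψ) → Tree Δ (ψ ⇒ χ) → Tree Δ (φ ⇒ χ)
    i∧I    : ∀ {φ ψ χ} → Tree Δ (φ ⇒ ψ) → Tree Δ (φ ⇒ χ) → Tree Δ (φ ⇒ ψ ∧̇ χ)
    i∨E    : ∀ {φ ψ χ} → Tree Δ (φ ⇒ χ) → Tree Δ (ψ ⇒ χ) → Tree Δ (φ ∨̇ ψ ⇒ χ)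
    i∀I    : ∀ {φ : Sent} {ψ : Form 1} → Tree Δ (∀̇ (embed φ ⇒ ψ)) → Tree Δ (φ ⇒ ∀̇ ψ)
    i∃E    : ∀ {φ : Form 1} {ψ : Sent} → Tree Δ (∀̇ (φ ⇒ embed ψ)) → Tree Δ (∃̇ φ ⇒ ψ)
    ∀I     : (i : ℕ) → ∀ {φ : Form 1} → Tree Δ (φ [ par i ]) → Tree Δ (∀̇ φ)
    ∀E     : ∀ {φ : Form 1} (t : Term 0) → Tree Δ (∀̇ φ) → Tree Δ (φ [ t ])
    CD     : ∀ {φ : Sent} {ψ : Form 1} → Tree Δ (∀̇ (embed φ ∨̇ ψ)) → Tree Δ (φ ∨̇ ∀̇ ψ)
    ∃I     : ∀ {φ : Form 1} (t : Term 0) → Tree Δ (φ [ t ]) → Tree Δ (∃̇ φ)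
    ∃E     : (i : ℕ) → ∀ {φ : Form 1} {ψ} → Tree Δ (∃̇ φ) → Tree (φ [ par i ] ∷ Δ) ψ → Tree Δ ψ
    -- the extra rule of N BQL_CD(Σ); the premise φ ⇒ ψ is a separate
    -- derivation none of whose leaves can be discharged below (hence
    -- restriction (i) holds by construction)
    MP     : ∀ {φ ψ} → Tree Δ φ → Tree [] (φ ⇒ ψ) → Tree Δ ψ

  -- OA k d χ : χ labels an open assumption occurrence of d, where the
  -- leaves pointing to the k innermost slots count as discharged inside d.
  OA : ∀ {Δ φ} → ℕ → Tree Δ φ → Sent → Set
  OA k (hyp φ) χ = χ ≡ φ
  OA k (dis {φ} x) χ = (k ≤ pos x) × (χ ≡ φ)
  OA k ⊤I χ = ⊥
  OA k (⊥E _ d) χ = OA k d χ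
  OA k (∧I d e) χ = OA k d χ ⊎ OA k e χ
  OA k (∧E₁ d) χ = OA k d χ
  OA k (∧E₂ d) χ = OA k d χ
  OA k (∨I₁ _ d) χ = OA k d χ
  OA k (∨I₂ _ d) χ = OA k d χ
  OA k (∨E d e f) χ = OA k d χ ⊎ OA (suc k) e χ ⊎ OA (suc k) f χ
  OA k (⇒I d) χ = OA (suc k) d χ
  OA k (iTrans d e) χ = OA k d χ ⊎ OA k e χ
  OA k (i∧I d e) χ = OA k d χ ⊎ OA k e χ
  OA k (i∨E d e) χ = OA k d χ ⊎ OA k e χ
  OA k (i∀I d) χ = OA k d χ
  OA k (i∃E d) χ = OA k d χ
  OA k (∀I _ d) χ = OA k d χ
  OA k (∀E _ d) χ = OA k d χ
  OA k (CD d) χ = OA k d χ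
  OA k (∃I _ d) χ = OA k d χ
  OA k (∃E _ d e) χ = OA k d χ ⊎ OA (suc k) e χ
  OA k (MP d e) χ = OA k d χ ⊎ OA 0 e χ

  Open : ∀ {Δ φ} → Tree Δ φ → Sent → Set
  Open = OA 0

  -- UnsafeOcc d χ : some occurrence of the assumption χ in d is unsafe, i.e.
  -- is an open assumption of the derivation of the premise φ ⇒ ψ of an
  -- application of the extra rule.
  UnsafeOcc : ∀ {Δ φ} → Tree Δ φ → Sent → Set
  UnsafeOcc (hyp _) χ = ⊥
  UnsafeOcc (dis _) χ = ⊥
  UnsafeOcc ⊤I χ = ⊥
  UnsafeOcc (⊥E _ d) χ = UnsafeOcc d χ
  UnsafeOcc (∧I d e) χ = UnsafeOcc d χ ⊎ UnsafeOcc e χ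
  UnsafeOcc (∧E₁ d) χ = UnsafeOcc d χ
  UnsafeOcc (∧E₂ d) χ = UnsafeOcc d χ
  UnsafeOcc (∨I₁ _ d) χ = UnsafeOcc d χ
  UnsafeOcc (∨I₂ _ d) χ = UnsafeOcc d χ
  UnsafeOcc (∨E d e f) χ = UnsafeOcc d χ ⊎ UnsafeOcc e χ ⊎ UnsafeOcc f χ
  UnsafeOcc (⇒I d) χ = UnsafeOcc d χ
  UnsafeOcc (iTrans d e) χ = UnsafeOcc d χ ⊎ UnsafeOcc e χ
  UnsafeOcc (i∧I d e) χ = UnsafeOcc d χ ⊎ UnsafeOcc e χ
  UnsafeOcc (i∨E d e) χ = UnsafeOcc d χ ⊎ UnsafeOcc e χ
  UnsafeOcc (i∀I d) χ = UnsafeOcc d χ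
  UnsafeOcc (i∃E d) χ = UnsafeOcc d χ
  UnsafeOcc (∀I _ d) χ = UnsafeOcc d χ
  UnsafeOcc (∀E _ d) χ = UnsafeOcc d χ
  UnsafeOcc (CD d) χ = UnsafeOcc d χ
  UnsafeOcc (∃I _ d) χ = UnsafeOcc d χ
  UnsafeOcc (∃E _ d e) χ = UnsafeOcc d χ ⊎ UnsafeOcc e χ
  UnsafeOcc (MP d e) χ = UnsafeOcc d χ ⊎ Open e χ

  -- which system: plain N BQL_CD, or N BQL_CD(Σ)
  data Mode : Set₁ where
    base : Mode
    withΣ : (Sent → Set) → Mode

  Valid : ∀ {Δ φ} → Mode → Tree Δ φ → Set
  Valid m (hyp _) = Data.Unit.⊤
  Valid m (dis _) = Data.Unit.⊤
  Valid m ⊤I = Data.Unit.⊤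
  Valid m (⊥E _ d) = Valid m d
  Valid m (∧I d e) = Valid m d × Valid m e
  Valid m (∧E₁ d) = Valid m d
  Valid m (∧E₂ d) = Valid m d
  Valid m (∨I₁ _ d) = Valid m d
  Valid m (∨I₂ _ d) = Valid m d
  Valid m (∨E d e f) = Valid m d × Valid m e × Valid m f
  Valid m (⇒I d) = Valid m d
  Valid m (iTrans d e) = Valid m d × Valid m e
  Valid m (i∧I d e) = Valid m d × Valid m e
  Valid m (i∨E d e) = Valid m d × Valid m e
  Valid m (i∀I d) = Valid m d
  Valid m (i∃E d) = Valid m d
  Valid m (∀I i {φ} d) =
    ¬ OccF i φ × (∀ χ → Open d χ → ¬ OccF i χ) × Valid m d
  Valid m (∀E _ d) = Valid m d
  Valid m (CD d) = Valid m d
  Valid m (∃I _ d) = Valid m d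
  Valid m (∃E i {φ} {ψ} d e) =
    ¬ OccF i φ × ¬ OccF i ψ
    × (∀ χ → Open e χ → χ ≡ φ [ par i ] ⊎ ¬ OccF i χ)
    × ¬ UnsafeOcc e (φ [ par i ])
    × Valid m d × Valid m e
  Valid base (MP d e) = ⊥
  Valid (withΣ Σs) (MP d e) =
    Valid base e × (∀ χ → Open e χ → Σs χ) × Valid (withΣ Σs) d

  _⊢_ : (Sent → Set) → Sent → Set
  Γ ⊢ φ = Σ[ d ∈ Tree [] φ ] Valid base d × (∀ χ → Open d χ → Γ χ)

  _⊢[_]_ : (Sent → Set) → (Sent → Set) → Sent → Set
  Δ ⊢[ Σs ] φ = Σ[ d ∈ Tree [] φ ] Valid (withΣ Σs) d × (∀ χ → Open d χ → Δ χ)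

-- The base system has no modus ponens, so a derivation cannot simply be
-- copied; instead every rule is internalised.  By induction on a valid
-- N BQL_CD(Σ)-derivation d of χ we build a *translation* of d: a finite list
-- of open assumptions of d (its premises) together with a base derivation of
-- ⋀ premises → χ whose own open assumptions are unsafe occurrences of d.
-- Each rule is replaced by its internal form (internal transitivity,
-- ∧-introduction, ∨-elimination, ∀-introduction, ∃-elimination); →-introduction
-- becomes exportation  (A ∧ φ → ψ) / (A → (φ → ψ)), and the extra rule becomes
-- internal transitivity with its Σ-derivable premise.  Restriction (ii) is what
-- keeps the eigenparameter of an ∃-elimination fresh for the assumptions of the
-- internal derivation.
-- Finally the premises lie in Σ ∪ Γ, and unsafe occurrences lie in Σ, so the
-- translation of the given derivation is turned into a derivation of ⋀Γ → φ.

module Submission where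

open import Defs
open import Data.Nat using (ℕ; zero; suc; _≤_; z≤n; s≤s)
open import Data.Nat.Properties using (<⇒≤)
open import Data.Fin using (Fin; inject₁)
import Data.Fin as Fin
open import Data.Vec using (Vec; []; _∷_)
open import Data.List using (List; []; _∷_; _++_; length)
open import Data.List.Membership.Propositional using (_∈_)
open import Data.List.Membership.Propositional.Properties using (∈-++⁺ˡ; ∈-++⁺ʳ; ∈-++⁻)
open import Data.List.Relation.Unary.Any using (here; there)
open import Data.Maybe using (just)
open import Data.Product using (Σ-syntax; _×_; _,_; proj₁; proj₂)
open import Data.Sum using (_⊎_; inj₁; inj₂) renaming (map to ⊎-map; [_,_] to either)
open import Data.Empty using (⊥-elim)
open import Data.Unit using (tt)
open import Function using (id; _∘_)
open import Relation.Nullary using (¬_)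
open import Relation.Unary using (_⊆′_; _∪_; _∩_)
open import Relation.Unary.Properties using (⊆′-refl)
open import Relation.Binary.PropositionalEquality using (_≡_; refl; sym; trans; cong; cong₂; subst)

module Deduction (𝓛 : Signature) where
  open FOL 𝓛

  variable
    Δ Θ : List Sent
    k : ℕ
    α β γ φ ψ χ : Sent
    O O′ O″ U U′ U″ P Q : Sent → Set

  Fresh : ∀ {n} → ℕ → Form n → Set
  Fresh i φ = ¬ OccF i φ

  open-antitone : ∀ k (t : Tree Δ α) → OA (suc k) t ⊆′ OA k t
  open-antitone k (hyp _) _ o = o
  open-antitone k (dis x) _ (p , e) = <⇒≤ p , e
  open-antitone k (⊥E _ d) ψ = open-antitone k d ψ
  open-antitone k (∧I d e) ψ = ⊎-map (open-antitone k d ψ) (open-antitone k e ψ)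
  open-antitone k (∧E₁ d) ψ = open-antitone k d ψ
  open-antitone k (∧E₂ d) ψ = open-antitone k d ψ
  open-antitone k (∨I₁ _ d) ψ = open-antitone k d ψ
  open-antitone k (∨I₂ _ d) ψ = open-antitone k d ψ
  open-antitone k (∨E d e f) ψ =
    ⊎-map (open-antitone k d ψ) (⊎-map (open-antitone (suc k) e ψ) (open-antitone (suc k) f ψ))
  open-antitone k (⇒I d) ψ = open-antitone (suc k) d ψ
  open-antitone k (iTrans d e) ψ = ⊎-map (open-antitone k d ψ) (open-antitone k e ψ)
  open-antitone k (i∧I d e) ψ = ⊎-map (open-antitone k d ψ) (open-antitone k e ψ)
  open-antitone k (i∨E d e) ψ = ⊎-map (open-antitone k d ψ) (open-antitone k e ψ)
  open-antitone k (i∀I d) ψ = open-antitone k d ψ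
  open-antitone k (i∃E d) ψ = open-antitone k d ψ
  open-antitone k (∀I _ d) ψ = open-antitone k d ψ
  open-antitone k (∀E _ d) ψ = open-antitone k d ψ
  open-antitone k (CD d) ψ = open-antitone k d ψ
  open-antitone k (∃I _ d) ψ = open-antitone k d ψ
  open-antitone k (∃E _ d e) ψ = ⊎-map (open-antitone k d ψ) (open-antitone (suc k) e ψ)
  open-antitone k (MP d e) ψ = ⊎-map (open-antitone k d ψ) id

  open-at-level⊆open : ∀ k (t : Tree Δ α) → OA k t ⊆′ Open t
  open-at-level⊆open zero t = ⊆′-refl
  open-at-level⊆open (suc k) t ψ = open-at-level⊆open k t ψ ∘ open-antitone k t ψ

  -- An unsafe occurrence is an open assumption occurrence, whatever the level:
  -- it sits in a premise derivation of the extra rule, which discharges nothing.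
  unsafe⊆open : ∀ k (t : Tree Δ α) → UnsafeOcc t ⊆′ OA k t
  unsafe⊆open k (⊥E _ d) ψ = unsafe⊆open k d ψ
  unsafe⊆open k (∧I d e) ψ = ⊎-map (unsafe⊆open k d ψ) (unsafe⊆open k e ψ)
  unsafe⊆open k (∧E₁ d) ψ = unsafe⊆open k d ψ
  unsafe⊆open k (∧E₂ d) ψ = unsafe⊆open k d ψ
  unsafe⊆open k (∨I₁ _ d) ψ = unsafe⊆open k d ψ
  unsafe⊆open k (∨I₂ _ d) ψ = unsafe⊆open k d ψ
  unsafe⊆open k (∨E d e f) ψ =
    ⊎-map (unsafe⊆open k d ψ) (⊎-map (unsafe⊆open (suc k) e ψ) (unsafe⊆open (suc k) f ψ))
  unsafe⊆open k (⇒I d) ψ = unsafe⊆open (suc k) d ψ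
  unsafe⊆open k (iTrans d e) ψ = ⊎-map (unsafe⊆open k d ψ) (unsafe⊆open k e ψ)
  unsafe⊆open k (i∧I d e) ψ = ⊎-map (unsafe⊆open k d ψ) (unsafe⊆open k e ψ)
  unsafe⊆open k (i∨E d e) ψ = ⊎-map (unsafe⊆open k d ψ) (unsafe⊆open k e ψ)
  unsafe⊆open k (i∀I d) ψ = unsafe⊆open k d ψ
  unsafe⊆open k (i∃E d) ψ = unsafe⊆open k d ψ
  unsafe⊆open k (∀I _ d) ψ = unsafe⊆open k d ψ
  unsafe⊆open k (∀E _ d) ψ = unsafe⊆open k d ψ
  unsafe⊆open k (CD d) ψ = unsafe⊆open k d ψ
  unsafe⊆open k (∃I _ d) ψ = unsafe⊆open k d ψ
  unsafe⊆open k (∃E _ d e) ψ = ⊎-map (unsafe⊆open k d ψ) (unsafe⊆open (suc k) e ψ)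
  unsafe⊆open k (MP d e) ψ = ⊎-map (unsafe⊆open k d ψ) id

  slot-split : (Θ : List Sent) (x : (Θ ++ φ ∷ Δ) ∋ χ) →
               length Θ ≤ pos x → suc (length Θ) ≤ pos x ⊎ χ ≡ φ
  slot-split [] here _ = inj₂ refl
  slot-split [] (there x) _ = inj₁ (s≤s z≤n)
  slot-split (_ ∷ Θ) (there x) (s≤s p) = ⊎-map s≤s id (slot-split Θ x p)

  -- An assumption open below slot φ is either open above it or is φ itself;
  -- this is how a discharging rule removes its assumption.
  open-split : (Θ : List Sent) (t : Tree (Θ ++ φ ∷ Δ) α) →
               OA (length Θ) t ⊆′ (OA (suc (length Θ)) t ∪ (_≡ φ))
  open-split Θ (hyp _) _ o = inj₁ o
  open-split Θ (dis x) _ (p , e) = ⊎-map (_, e) (trans e) (slot-split Θ x p)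
  open-split Θ (⊥E _ d) ψ = open-split Θ d ψ
  open-split Θ (∧I d e) ψ = either (⊎-map inj₁ id ∘ open-split Θ d ψ) (⊎-map inj₂ id ∘ open-split Θ e ψ)
  open-split Θ (∧E₁ d) ψ = open-split Θ d ψ
  open-split Θ (∧E₂ d) ψ = open-split Θ d ψ
  open-split Θ (∨I₁ _ d) ψ = open-split Θ d ψ
  open-split Θ (∨I₂ _ d) ψ = open-split Θ d ψ
  open-split Θ (∨E d e f) ψ =
    either (⊎-map inj₁ id ∘ open-split Θ d ψ)
           (either (⊎-map (inj₂ ∘ inj₁) id ∘ open-split (_ ∷ Θ) e ψ)
                   (⊎-map (inj₂ ∘ inj₂) id ∘ open-split (_ ∷ Θ) f ψ))
  open-split Θ (⇒I d) ψ = open-split (_ ∷ Θ) d ψ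
  open-split Θ (iTrans d e) ψ = either (⊎-map inj₁ id ∘ open-split Θ d ψ) (⊎-map inj₂ id ∘ open-split Θ e ψ)
  open-split Θ (i∧I d e) ψ = either (⊎-map inj₁ id ∘ open-split Θ d ψ) (⊎-map inj₂ id ∘ open-split Θ e ψ)
  open-split Θ (i∨E d e) ψ = either (⊎-map inj₁ id ∘ open-split Θ d ψ) (⊎-map inj₂ id ∘ open-split Θ e ψ)
  open-split Θ (i∀I d) ψ = open-split Θ d ψ
  open-split Θ (i∃E d) ψ = open-split Θ d ψ
  open-split Θ (∀I _ d) ψ = open-split Θ d ψ
  open-split Θ (∀E _ d) ψ = open-split Θ d ψ
  open-split Θ (CD d) ψ = open-split Θ d ψ
  open-split Θ (∃I _ d) ψ = open-split Θ d ψ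
  open-split Θ (∃E _ d e) ψ =
    either (⊎-map inj₁ id ∘ open-split Θ d ψ) (⊎-map inj₂ id ∘ open-split (_ ∷ Θ) e ψ)
  open-split Θ (MP d e) ψ = either (⊎-map inj₁ id ∘ open-split Θ d ψ) (inj₁ ∘ inj₂)

  -- Placing a tree in a longer context (more slots below it).  Needed to use
  -- a closed base derivation underneath an →-introduction.

  slot-extend : (Δ : List Sent) → Θ ∋ α → (Θ ++ Δ) ∋ α
  slot-extend Δ here = here
  slot-extend Δ (there x) = there (slot-extend Δ x)

  pos-slot-extend : (Δ : List Sent) (x : Θ ∋ α) → pos (slot-extend Δ x) ≡ pos x
  pos-slot-extend Δ here = refl
  pos-slot-extend Δ (there x) = cong suc (pos-slot-extend Δ x)

  extend : (Δ : List Sent) → Tree Θ α → Tree (Θ ++ Δ) α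
  extend Δ (hyp φ) = hyp φ
  extend Δ (dis x) = dis (slot-extend Δ x)
  extend Δ ⊤I = ⊤I
  extend Δ (⊥E φ d) = ⊥E φ (extend Δ d)
  extend Δ (∧I d e) = ∧I (extend Δ d) (extend Δ e)
  extend Δ (∧E₁ d) = ∧E₁ (extend Δ d)
  extend Δ (∧E₂ d) = ∧E₂ (extend Δ d)
  extend Δ (∨I₁ ψ d) = ∨I₁ ψ (extend Δ d)
  extend Δ (∨I₂ φ d) = ∨I₂ φ (extend Δ d)
  extend Δ (∨E d e f) = ∨E (extend Δ d) (extend Δ e) (extend Δ f)
  extend Δ (⇒I d) = ⇒I (extend Δ d)
  extend Δ (iTrans d e) = iTrans (extend Δ d) (extend Δ e)
  extend Δ (i∧I d e) = i∧I (extend Δ d) (extend Δ e)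
  extend Δ (i∨E d e) = i∨E (extend Δ d) (extend Δ e)
  extend Δ (i∀I d) = i∀I (extend Δ d)
  extend Δ (i∃E d) = i∃E (extend Δ d)
  extend Δ (∀I i d) = ∀I i (extend Δ d)
  extend Δ (∀E t d) = ∀E t (extend Δ d)
  extend Δ (CD d) = CD (extend Δ d)
  extend Δ (∃I t d) = ∃I t (extend Δ d)
  extend Δ (∃E i d e) = ∃E i (extend Δ d) (extend Δ e)
  extend Δ (MP d e) = MP (extend Δ d) e

  open-extend : (Δ : List Sent) → ∀ k (t : Tree Θ α) → OA k (extend Δ t) ⊆′ OA k t
  open-extend Δ k (hyp _) _ o = o
  open-extend Δ k (dis x) _ (p , e) = subst (k ≤_) (pos-slot-extend Δ x) p , e
  open-extend Δ k (⊥E _ d) ψ = open-extend Δ k d ψ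
  open-extend Δ k (∧I d e) ψ = ⊎-map (open-extend Δ k d ψ) (open-extend Δ k e ψ)
  open-extend Δ k (∧E₁ d) ψ = open-extend Δ k d ψ
  open-extend Δ k (∧E₂ d) ψ = open-extend Δ k d ψ
  open-extend Δ k (∨I₁ _ d) ψ = open-extend Δ k d ψ
  open-extend Δ k (∨I₂ _ d) ψ = open-extend Δ k d ψ
  open-extend Δ k (∨E d e f) ψ =
    ⊎-map (open-extend Δ k d ψ) (⊎-map (open-extend Δ (suc k) e ψ) (open-extend Δ (suc k) f ψ))
  open-extend Δ k (⇒I d) ψ = open-extend Δ (suc k) d ψ
  open-extend Δ k (iTrans d e) ψ = ⊎-map (open-extend Δ k d ψ) (open-extend Δ k e ψ)
  open-extend Δ k (i∧I d e) ψ = ⊎-map (open-extend Δ k d ψ) (open-extend Δ k e ψ)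
  open-extend Δ k (i∨E d e) ψ = ⊎-map (open-extend Δ k d ψ) (open-extend Δ k e ψ)
  open-extend Δ k (i∀I d) ψ = open-extend Δ k d ψ
  open-extend Δ k (i∃E d) ψ = open-extend Δ k d ψ
  open-extend Δ k (∀I _ d) ψ = open-extend Δ k d ψ
  open-extend Δ k (∀E _ d) ψ = open-extend Δ k d ψ
  open-extend Δ k (CD d) ψ = open-extend Δ k d ψ
  open-extend Δ k (∃I _ d) ψ = open-extend Δ k d ψ
  open-extend Δ k (∃E _ d e) ψ = ⊎-map (open-extend Δ k d ψ) (open-extend Δ (suc k) e ψ)
  open-extend Δ k (MP d e) ψ = ⊎-map (open-extend Δ k d ψ) id

  unsafe-extend : (Δ : List Sent) (t : Tree Θ α) → UnsafeOcc (extend Δ t) ⊆′ UnsafeOcc t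
  unsafe-extend Δ (⊥E _ d) ψ = unsafe-extend Δ d ψ
  unsafe-extend Δ (∧I d e) ψ = ⊎-map (unsafe-extend Δ d ψ) (unsafe-extend Δ e ψ)
  unsafe-extend Δ (∧E₁ d) ψ = unsafe-extend Δ d ψ
  unsafe-extend Δ (∧E₂ d) ψ = unsafe-extend Δ d ψ
  unsafe-extend Δ (∨I₁ _ d) ψ = unsafe-extend Δ d ψ
  unsafe-extend Δ (∨I₂ _ d) ψ = unsafe-extend Δ d ψ
  unsafe-extend Δ (∨E d e f) ψ =
    ⊎-map (unsafe-extend Δ d ψ) (⊎-map (unsafe-extend Δ e ψ) (unsafe-extend Δ f ψ))
  unsafe-extend Δ (⇒I d) ψ = unsafe-extend Δ d ψ
  unsafe-extend Δ (iTrans d e) ψ = ⊎-map (unsafe-extend Δ d ψ) (unsafe-extend Δ e ψ)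
  unsafe-extend Δ (i∧I d e) ψ = ⊎-map (unsafe-extend Δ d ψ) (unsafe-extend Δ e ψ)
  unsafe-extend Δ (i∨E d e) ψ = ⊎-map (unsafe-extend Δ d ψ) (unsafe-extend Δ e ψ)
  unsafe-extend Δ (i∀I d) ψ = unsafe-extend Δ d ψ
  unsafe-extend Δ (i∃E d) ψ = unsafe-extend Δ d ψ
  unsafe-extend Δ (∀I _ d) ψ = unsafe-extend Δ d ψ
  unsafe-extend Δ (∀E _ d) ψ = unsafe-extend Δ d ψ
  unsafe-extend Δ (CD d) ψ = unsafe-extend Δ d ψ
  unsafe-extend Δ (∃I _ d) ψ = unsafe-extend Δ d ψ
  unsafe-extend Δ (∃E _ d e) ψ = ⊎-map (unsafe-extend Δ d ψ) (unsafe-extend Δ e ψ)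
  unsafe-extend Δ (MP d e) ψ = ⊎-map (unsafe-extend Δ d ψ) id

  valid-extend : (Δ : List Sent) (t : Tree Θ α) → Valid base t → Valid base (extend Δ t)
  valid-extend Δ (hyp _) v = v
  valid-extend Δ (dis x) v = v
  valid-extend Δ ⊤I v = v
  valid-extend Δ (⊥E _ d) v = valid-extend Δ d v
  valid-extend Δ (∧I d e) (v , w) = valid-extend Δ d v , valid-extend Δ e w
  valid-extend Δ (∧E₁ d) v = valid-extend Δ d v
  valid-extend Δ (∧E₂ d) v = valid-extend Δ d v
  valid-extend Δ (∨I₁ _ d) v = valid-extend Δ d v
  valid-extend Δ (∨I₂ _ d) v = valid-extend Δ d v
  valid-extend Δ (∨E d e f) (u , v , w) = valid-extend Δ d u , valid-extend Δ e v , valid-extend Δ f w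
  valid-extend Δ (⇒I d) v = valid-extend Δ d v
  valid-extend Δ (iTrans d e) (v , w) = valid-extend Δ d v , valid-extend Δ e w
  valid-extend Δ (i∧I d e) (v , w) = valid-extend Δ d v , valid-extend Δ e w
  valid-extend Δ (i∨E d e) (v , w) = valid-extend Δ d v , valid-extend Δ e w
  valid-extend Δ (i∀I d) v = valid-extend Δ d v
  valid-extend Δ (i∃E d) v = valid-extend Δ d v
  valid-extend Δ (∀I i d) (fφ , fO , v) = fφ , (λ χ → fO χ ∘ open-extend Δ 0 d χ) , valid-extend Δ d v
  valid-extend Δ (∀E _ d) v = valid-extend Δ d v
  valid-extend Δ (CD d) v = valid-extend Δ d v
  valid-extend Δ (∃I _ d) v = valid-extend Δ d v
  valid-extend Δ (∃E i d e) (fφ , fψ , fO , safe , v , w) =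
    fφ , fψ , (λ χ → fO χ ∘ open-extend Δ 0 e χ) , safe ∘ unsafe-extend Δ e _ ,
    valid-extend Δ d v , valid-extend Δ e w

  split-inject₁ : ∀ {n} (i : Fin n) → split (inject₁ i) ≡ just i
  split-inject₁ {suc n} Fin.zero = refl
  split-inject₁ {suc n} (Fin.suc i) rewrite split-inject₁ i = refl

  mutual
    subst-wkT : ∀ {n} (t : Term 0) (u : Term n) → substT t (wkT u) ≡ u
    subst-wkT t (var i) rewrite split-inject₁ i = refl
    subst-wkT t (par j) = refl
    subst-wkT t (fn f ts) = cong (fn f) (subst-wkTs t ts)

    subst-wkTs : ∀ {n m} (t : Term 0) (us : Vec (Term n) m) → substTs t (wkTs us) ≡ us
    subst-wkTs t [] = refl
    subst-wkTs t (u ∷ us) = cong₂ _∷_ (subst-wkT t u) (subst-wkTs t us)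

  subst-embed : ∀ {n} (t : Term 0) (A : Form n) → substF t (embed A) ≡ A
  subst-embed t (atom R ts) = cong (atom R) (subst-wkTs t ts)
  subst-embed t ⊤̇ = refl
  subst-embed t ⊥̇ = refl
  subst-embed t (A ∧̇ B) = cong₂ _∧̇_ (subst-embed t A) (subst-embed t B)
  subst-embed t (A ∨̇ B) = cong₂ _∨̇_ (subst-embed t A) (subst-embed t B)
  subst-embed t (A ⇒ B) = cong₂ _⇒_ (subst-embed t A) (subst-embed t B)
  subst-embed t (∀̇ A) = cong ∀̇ (subst-embed t A)
  subst-embed t (∃̇ A) = cong ∃̇ (subst-embed t A)

  mutual
    occ-wkT : ∀ {n} i (u : Term n) → OccT i (wkT u) → OccT i u
    occ-wkT i (par j) o = o
    occ-wkT i (fn f ts) o = occ-wkTs i ts o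

    occ-wkTs : ∀ {n m} i (us : Vec (Term n) m) → OccTs i (wkTs us) → OccTs i us
    occ-wkTs i (u ∷ us) = ⊎-map (occ-wkT i u) (occ-wkTs i us)

  fresh-embed : ∀ {n} i (A : Form n) → Fresh i A → Fresh i (embed A)
  fresh-embed i A fA = fA ∘ occ-embed A
    where
      occ-embed : ∀ {n} (A : Form n) → OccF i (embed A) → OccF i A
      occ-embed (atom R ts) = occ-wkTs i ts
      occ-embed (A ∧̇ B) = ⊎-map (occ-embed A) (occ-embed B)
      occ-embed (A ∨̇ B) = ⊎-map (occ-embed A) (occ-embed B)
      occ-embed (A ⇒ B) = ⊎-map (occ-embed A) (occ-embed B)
      occ-embed (∀̇ A) = occ-embed A
      occ-embed (∃̇ A) = occ-embed A

  -- Base derivations: valid N BQL_CD trees in context Δ all of whose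
  -- assumptions not discharged within Δ satisfy P.  A schema is a closed base
  -- derivation, usable under any assumption predicate.

  Der : List Sent → Sent → (Sent → Set) → Set
  Der Δ χ P = Σ[ t ∈ Tree Δ χ ] Valid base t × OA (length Δ) t ⊆′ P

  Schema : Sent → Set₁
  Schema χ = ∀ {P} → Der [] χ P

  loosen : P ⊆′ Q → Der Δ α P → Der Δ α Q
  loosen P⊆Q (t , v , o) = t , v , λ ψ → P⊆Q ψ ∘ o ψ

  transportᴰ : α ≡ β → Der Δ α P → Der Δ β P
  transportᴰ refl D = D

  var₀ : Der (α ∷ Δ) α P
  var₀ = dis here , tt , λ { _ (() , _) }

  var₁ : Der (β ∷ α ∷ Δ) α P
  var₁ = dis (there here) , tt , λ { _ (s≤s () , _) }

  assume : Der Δ α (_≡ α)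
  assume {α = α} = hyp α , tt , λ _ e → e

  ⊤Iᴰ : Der Δ ⊤̇ P
  ⊤Iᴰ = ⊤I , tt , λ _ ()

  ⇒Iᴰ : Der (α ∷ Δ) β P → Der Δ (α ⇒ β) P
  ⇒Iᴰ (t , v , o) = ⇒I t , v , o

  ⊥Eᴰ : (φ : Sent) → Der Δ ⊥̇ P → Der Δ φ P
  ⊥Eᴰ φ (t , v , o) = ⊥E φ t , v , o

  ∧Iᴰ : Der Δ α P → Der Δ β P → Der Δ (α ∧̇ β) P
  ∧Iᴰ (t , v , o) (u , w , p) = ∧I t u , (v , w) , λ ψ → either (o ψ) (p ψ)

  ∧E₁ᴰ : Der Δ (α ∧̇ β) P → Der Δ α P
  ∧E₁ᴰ (t , v , o) = ∧E₁ t , v , o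

  ∧E₂ᴰ : Der Δ (α ∧̇ β) P → Der Δ β P
  ∧E₂ᴰ (t , v , o) = ∧E₂ t , v , o

  ∨I₁ᴰ : (β : Sent) → Der Δ α P → Der Δ (α ∨̇ β) P
  ∨I₁ᴰ β (t , v , o) = ∨I₁ β t , v , o

  ∨I₂ᴰ : (α : Sent) → Der Δ β P → Der Δ (α ∨̇ β) P
  ∨I₂ᴰ α (t , v , o) = ∨I₂ α t , v , o

  ∨Eᴰ : Der Δ (α ∨̇ β) P → Der (α ∷ Δ) γ P → Der (β ∷ Δ) γ P → Der Δ γ P
  ∨Eᴰ (t , v , o) (u , w , p) (s , x , q) =
    ∨E t u s , (v , w , x) , λ ψ → either (o ψ) (either (p ψ) (q ψ))

  iTransᴰ : Der Δ (α ⇒ β) P → Der Δ (β ⇒ γ) P → Der Δ (α ⇒ γ) P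
  iTransᴰ (t , v , o) (u , w , p) = iTrans t u , (v , w) , λ ψ → either (o ψ) (p ψ)

  i∧Iᴰ : Der Δ (α ⇒ β) P → Der Δ (α ⇒ γ) P → Der Δ (α ⇒ β ∧̇ γ) P
  i∧Iᴰ (t , v , o) (u , w , p) = i∧I t u , (v , w) , λ ψ → either (o ψ) (p ψ)

  i∨Eᴰ : Der Δ (α ⇒ γ) P → Der Δ (β ⇒ γ) P → Der Δ (α ∨̇ β ⇒ γ) P
  i∨Eᴰ (t , v , o) (u , w , p) = i∨E t u , (v , w) , λ ψ → either (o ψ) (p ψ)

  i∀Iᴰ : {ψ : Form 1} → Der Δ (∀̇ (embed α ⇒ ψ)) P → Der Δ (α ⇒ ∀̇ ψ) P
  i∀Iᴰ (t , v , o) = i∀I t , v , o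

  i∃Eᴰ : {φ : Form 1} → Der Δ (∀̇ (φ ⇒ embed α)) P → Der Δ (∃̇ φ ⇒ α) P
  i∃Eᴰ (t , v , o) = i∃E t , v , o

  -- ∀-introduction needs a_i fresh for the formula and for every open
  -- assumption, hence for everything allowed by P.
  ∀Iᴰ : ∀ i {φ : Form 1} → Fresh i φ → P ⊆′ Fresh i → Der [] (φ [ par i ]) P → Der [] (∀̇ φ) P
  ∀Iᴰ i fφ fP (t , v , o) = ∀I i t , (fφ , (λ χ → fP χ ∘ o χ) , v) , o

  ∀Eᴰ : {φ : Form 1} (t : Term 0) → Der Δ (∀̇ φ) P → Der Δ (φ [ t ]) P
  ∀Eᴰ t (u , v , o) = ∀E t u , v , o

  ∃Iᴰ : {φ : Form 1} (t : Term 0) → Der Δ (φ [ t ]) P → Der Δ (∃̇ φ) P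
  ∃Iᴰ t (u , v , o) = ∃I t u , v , o

  CDᴰ : {ψ : Form 1} → Der Δ (∀̇ (embed α ∨̇ ψ)) P → Der Δ (α ∨̇ ∀̇ ψ) P
  CDᴰ (t , v , o) = CD t , v , o

  liftᴰ : Der [] α P → Der Δ α P
  liftᴰ {Δ = Δ} (t , v , o) =
    extend Δ t , valid-extend Δ t v ,
    λ ψ → o ψ ∘ open-at-level⊆open (length Δ) t ψ ∘ open-extend Δ (length Δ) t ψ

  identity : Schema (α ⇒ α)
  identity = ⇒Iᴰ var₀

  exportation : Der [] (α ∧̇ β ⇒ γ) P → Der [] (α ⇒ (β ⇒ γ)) P
  exportation D = ⇒Iᴰ (iTransᴰ (⇒Iᴰ (∧Iᴰ var₁ var₀)) (liftᴰ D))

  ∧-monoˡ : Der [] (α ⇒ β) P → Der [] (α ∧̇ γ ⇒ β ∧̇ γ) P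
  ∧-monoˡ D = i∧Iᴰ (iTransᴰ (⇒Iᴰ (∧E₁ᴰ var₀)) D) (⇒Iᴰ (∧E₂ᴰ var₀))

  ∨-internal : Der [] (α ∧̇ β ⇒ χ) P → Der [] (α ∧̇ γ ⇒ χ) P → Der [] (α ∧̇ (β ∨̇ γ) ⇒ χ) P
  ∨-internal D E = iTransᴰ distribute (i∨Eᴰ D E)
    where
      distribute : Schema (α ∧̇ (β ∨̇ γ) ⇒ (α ∧̇ β) ∨̇ (α ∧̇ γ))
      distribute = ⇒Iᴰ (∨Eᴰ (∧E₂ᴰ var₀)
                             (∨I₁ᴰ _ (∧Iᴰ (∧E₁ᴰ var₁) var₀))
                             (∨I₂ᴰ _ (∧Iᴰ (∧E₁ᴰ var₁) var₀)))

  ∀-internal : ∀ i {A : Sent} {φ : Form 1} → Fresh i A → Fresh i φ → P ⊆′ Fresh i →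
               Der [] (A ⇒ φ [ par i ]) P → Der [] (A ⇒ ∀̇ φ) P
  ∀-internal i {A} {φ} fA fφ fP D =
    i∀Iᴰ (∀Iᴰ i (either (fresh-embed i A fA) fφ) fP
           (transportᴰ (cong (_⇒ φ [ par i ]) (sym (subst-embed (par i) A))) D))

  ∃-internal : ∀ i {φ : Form 1} {ψ : Sent} → Fresh i φ → Fresh i ψ → P ⊆′ Fresh i →
               Der [] (φ [ par i ] ⇒ ψ) P → Der [] (∃̇ φ ⇒ ψ) P
  ∃-internal i {φ} {ψ} fφ fψ fP D =
    i∃Eᴰ (∀Iᴰ i (either fφ (fresh-embed i ψ fψ)) fP
           (transportᴰ (cong (φ [ par i ] ⇒_) (sym (subst-embed (par i) ψ))) D))

  ∧∃-shift : ∀ i {A : Sent} {φ : Form 1} → Fresh i A → Fresh i φ →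
             Schema (A ∧̇ ∃̇ φ ⇒ ∃̇ (embed A ∧̇ φ))
  ∧∃-shift i {A} {φ} fA fφ =
    transportᴰ (cong (λ B → B ∧̇ ∃̇ φ ⇒ ∃̇ (embed A ∧̇ φ)) (subst-embed (par i) A)) shift
    where
      A′ : Sent
      A′ = substF (par i) (embed A)
      fA′ : Fresh i A′
      fA′ = fA ∘ subst (OccF i) (subst-embed (par i) A)
      minor-open : ∀ χ → (0 ≤ 1 × χ ≡ A′ ∧̇ ∃̇ φ) ⊎ (0 ≤ 0 × χ ≡ φ [ par i ]) →
                   χ ≡ φ [ par i ] ⊎ Fresh i χ
      minor-open χ (inj₁ (_ , refl)) = inj₂ (either fA′ fφ)
      minor-open χ (inj₂ (_ , eq)) = inj₁ eq
      shift : Schema (A′ ∧̇ ∃̇ φ ⇒ ∃̇ (embed A ∧̇ φ))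
      shift = ⇒I (∃E i (∧E₂ (dis here)) (∃I (par i) (∧I (∧E₁ (dis (there here))) (dis here))))
            , (fφ , either (fresh-embed i A fA) fφ , minor-open , either (λ ()) (λ ()) , tt , tt , tt)
            , λ { _ (inj₁ (() , _)) ; _ (inj₂ (inj₁ (s≤s () , _))) ; _ (inj₂ (inj₂ (() , _))) }

  ∃-internal-with : ∀ i {A : Sent} {φ : Form 1} {ψ : Sent} →
                    Fresh i A → Fresh i φ → Fresh i ψ → P ⊆′ Fresh i →
                    Der [] (A ∧̇ φ [ par i ] ⇒ ψ) P → Der [] (A ∧̇ ∃̇ φ ⇒ ψ) P
  ∃-internal-with i {A} {φ} fA fφ fψ fP D =
    iTransᴰ (∧∃-shift i fA fφ)
            (∃-internal i (either (fresh-embed i A fA) fφ) fψ fP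
              (transportᴰ (cong (λ B → B ∧̇ φ [ par i ] ⇒ _) (sym (subst-embed (par i) A))) D))

  ⋀-elim : ∀ {Γ x} → x ∈ Γ → Der Δ (⋀ Γ) P → Der Δ x P
  ⋀-elim {Γ = _ ∷ []} (here refl) D = D
  ⋀-elim {Γ = _ ∷ _ ∷ _} (here refl) D = ∧E₁ᴰ D
  ⋀-elim {Γ = _ ∷ _ ∷ _} (there m) D = ⋀-elim m (∧E₂ᴰ D)

  ⋀-intro : (Γ : List Sent) → (∀ x → x ∈ Γ → Der Δ x P) → Der Δ (⋀ Γ) P
  ⋀-intro [] D = ⊤Iᴰ
  ⋀-intro (x ∷ []) D = D x (here refl)
  ⋀-intro (x ∷ y ∷ Γ) D = ∧Iᴰ (D x (here refl)) (⋀-intro (y ∷ Γ) (λ z → D z ∘ there))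

  ⋀-fresh : ∀ i (Γ : List Sent) → (_∈ Γ) ⊆′ Fresh i → Fresh i (⋀ Γ)
  ⋀-fresh i [] f ()
  ⋀-fresh i (x ∷ []) f = f x (here refl)
  ⋀-fresh i (x ∷ y ∷ Γ) f = either (f x (here refl)) (⋀-fresh i (y ∷ Γ) (λ z → f z ∘ there))

  ⋀-mono : {Γ Γ′ : List Sent} → (_∈ Γ) ⊆′ (_∈ Γ′) → Schema (⋀ Γ′ ⇒ ⋀ Γ)
  ⋀-mono {Γ} Γ⊆Γ′ = ⇒Iᴰ (⋀-intro Γ (λ x m → ⋀-elim (Γ⊆Γ′ x m) var₀))

  ⋀-cover : {Γ M : List Sent} → (_∈ Γ) ⊆′ ((_∈ M) ∪ (_≡ φ)) → Schema (⋀ M ∧̇ φ ⇒ ⋀ Γ)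
  ⋀-cover {φ = φ} {Γ = Γ} {M = M} cover {P} = ⇒Iᴰ (⋀-intro Γ (λ x m → member x (cover x m)))
    where
      member : ∀ x → x ∈ M ⊎ x ≡ φ → Der (⋀ M ∧̇ φ ∷ []) x P
      member x (inj₁ m) = ⋀-elim m (∧E₁ᴰ var₀)
      member x (inj₂ refl) = ∧E₂ᴰ var₀

  ++⊆ˡ : (Γ Γ′ : List Sent) → (_∈ Γ) ⊆′ (_∈ Γ ++ Γ′)
  ++⊆ˡ Γ Γ′ _ = ∈-++⁺ˡ

  ++⊆ʳ : (Γ Γ′ : List Sent) → (_∈ Γ′) ⊆′ (_∈ Γ ++ Γ′)
  ++⊆ʳ Γ Γ′ _ = ∈-++⁺ʳ Γ

  strip : (Γ : List Sent) → (_∈ Γ) ⊆′ (Q ∪ (_≡ φ)) →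
          Σ[ M ∈ List Sent ] (_∈ M) ⊆′ Q × (_∈ Γ) ⊆′ ((_∈ M) ∪ (_≡ φ))
  strip [] _ = [] , (λ _ ()) , (λ _ ())
  strip {Q = Q} {φ = φ} (x ∷ Γ) sort with strip Γ (λ z → sort z ∘ there) | sort x (here refl)
  ... | M , M⊆Q , cover | inj₁ q = x ∷ M , kept , covered
    where
      kept : (_∈ x ∷ M) ⊆′ Q
      kept _ (here refl) = q
      kept z (there m) = M⊆Q z m
      covered : (_∈ x ∷ Γ) ⊆′ ((_∈ x ∷ M) ∪ (_≡ φ))
      covered _ (here refl) = inj₁ (here refl)
      covered z (there m) = ⊎-map there id (cover z m)
  ... | M , M⊆Q , cover | inj₂ eq = M , M⊆Q , covered
    where
      covered : (_∈ x ∷ Γ) ⊆′ ((_∈ M) ∪ (_≡ φ))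
      covered _ (here refl) = inj₂ eq
      covered z (there m) = cover z m

  record Translation (O U : Sent → Set) (χ : Sent) : Set where
    constructor translation
    field
      premises : List Sent
      premises-open : (_∈ premises) ⊆′ O
      internal : Der [] (⋀ premises ⇒ χ) U

  relabel : O ⊆′ O′ → U ⊆′ U′ → Translation O U χ → Translation O′ U′ χ
  relabel O⊆O′ U⊆U′ (translation Γ Γ⊆O D) =
    translation Γ (λ x → O⊆O′ x ∘ Γ⊆O x) (loosen U⊆U′ D)

  single : O α → Translation O U α
  single {α = α} o = translation (α ∷ []) (λ { _ (here refl) → o }) identity

  trivial : Translation O U ⊤̇
  trivial = translation [] (λ _ ()) (⇒Iᴰ ⊤Iᴰ)

  step₁ : Translation O U α → Schema (α ⇒ β) → Translation O U β
  step₁ (translation Γ Γ⊆O D) K = translation Γ Γ⊆O (iTransᴰ D K)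

  step₂ : Translation O U α → Translation O′ U′ β → Schema (α ∧̇ β ⇒ γ) →
          Translation (O ∪ O′) (U ∪ U′) γ
  step₂ (translation Γ Γ⊆O D) (translation Γ′ Γ′⊆O′ E) K =
    translation (Γ ++ Γ′) (λ x → either (inj₁ ∘ Γ⊆O x) (inj₂ ∘ Γ′⊆O′ x) ∘ ∈-++⁻ Γ)
      (iTransᴰ (i∧Iᴰ (iTransᴰ (⋀-mono (++⊆ˡ Γ Γ′)) (loosen (λ _ → inj₁) D))
                     (iTransᴰ (⋀-mono (++⊆ʳ Γ Γ′)) (loosen (λ _ → inj₂) E)))
               K)

  modus-ponens : Translation O U α → Der [] (α ⇒ β) U′ → Translation O (U ∪ U′) β
  modus-ponens (translation Γ Γ⊆O D) E =
    translation Γ Γ⊆O (iTransᴰ (loosen (λ _ → inj₁) D) (loosen (λ _ → inj₂) E))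

  absorb : Translation (O ∪ (_≡ φ)) U χ →
           Σ[ M ∈ List Sent ] (_∈ M) ⊆′ O × Der [] (⋀ M ∧̇ φ ⇒ χ) U
  absorb (translation Γ sort D) with strip Γ sort
  ... | M , M⊆O , cover = M , M⊆O , iTransᴰ (⋀-cover cover) D

  discharge : Translation (O ∪ (_≡ φ)) U ψ → Translation O U (φ ⇒ ψ)
  discharge t with absorb t
  ... | M , M⊆O , D = translation M M⊆O (exportation D)

  case-split : Translation O U (φ ∨̇ ψ) →
               Translation (O′ ∪ (_≡ φ)) U′ χ → Translation (O″ ∪ (_≡ ψ)) U″ χ →
               Translation (O ∪ O′ ∪ O″) (U ∪ U′ ∪ U″) χ
  case-split {O = O} {O′ = O′} {O″ = O″} (translation Γ Γ⊆O D) e f with absorb e | absorb f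
  ... | M′ , M′⊆O′ , E | M″ , M″⊆O″ , F =
    translation N N⊆O
      (iTransᴰ (i∧Iᴰ identity (iTransᴰ (⋀-mono (++⊆ˡ Γ (M′ ++ M″))) (loosen (λ _ → inj₁) D)))
               (∨-internal (iTransᴰ (∧-monoˡ (⋀-mono M′⊆N))
                                    (loosen (λ _ → inj₂ ∘ inj₁) E))
                           (iTransᴰ (∧-monoˡ (⋀-mono M″⊆N))
                                    (loosen (λ _ → inj₂ ∘ inj₂) F))))
    where
      N : List Sent
      N = Γ ++ M′ ++ M″
      M′⊆N : (_∈ M′) ⊆′ (_∈ N)
      M′⊆N _ = ∈-++⁺ʳ Γ ∘ ∈-++⁺ˡ
      M″⊆N : (_∈ M″) ⊆′ (_∈ N)
      M″⊆N _ = ∈-++⁺ʳ Γ ∘ ∈-++⁺ʳ M′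
      N⊆O : (_∈ N) ⊆′ (O ∪ O′ ∪ O″)
      N⊆O x m with ∈-++⁻ Γ m
      ... | inj₁ m′ = inj₁ (Γ⊆O x m′)
      ... | inj₂ m′ = inj₂ (⊎-map (M′⊆O′ x) (M″⊆O″ x) (∈-++⁻ M′ m′))

  generalize : ∀ i {φ : Form 1} → Fresh i φ → O ⊆′ Fresh i → U ⊆′ Fresh i →
               Translation O U (φ [ par i ]) → Translation O U (∀̇ φ)
  generalize i fφ fO fU (translation Γ Γ⊆O D) =
    translation Γ Γ⊆O (∀-internal i (⋀-fresh i Γ (λ x → fO x ∘ Γ⊆O x)) fφ fU D)

  exists-elim : ∀ i {φ : Form 1} → Fresh i φ → Fresh i ψ → U′ ⊆′ Fresh i →
                Translation O U (∃̇ φ) →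
                Translation ((O′ ∩ Fresh i) ∪ (_≡ φ [ par i ])) U′ ψ →
                Translation (O ∪ O′) (U ∪ U′) ψ
  exists-elim i fφ fψ fU′ (translation Γ Γ⊆O D) e with absorb e
  ... | M , M⊆O′ , E =
    translation (Γ ++ M) (λ x → either (inj₁ ∘ Γ⊆O x) (inj₂ ∘ proj₁ ∘ M⊆O′ x) ∘ ∈-++⁻ Γ)
      (iTransᴰ (i∧Iᴰ (⋀-mono (++⊆ʳ Γ M)) (iTransᴰ (⋀-mono (++⊆ˡ Γ M)) (loosen (λ _ → inj₁) D)))
               (loosen (λ _ → inj₂) (∃-internal-with i fM fφ fψ fU′ E)))
    where
      fM : Fresh i (⋀ M)
      fM = ⋀-fresh i M (λ x → proj₂ ∘ M⊆O′ x)

  module _ (Σs : Sent → Set) where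

    -- unsafe occurrences are open assumptions of premise derivations of the
    -- extra rule, and these lie in Σ
    unsafe⊆Σ : (t : Tree Δ α) → Valid (withΣ Σs) t → UnsafeOcc t ⊆′ Σs
    unsafe⊆Σ (⊥E _ d) v = unsafe⊆Σ d v
    unsafe⊆Σ (∧I d e) (v , w) ψ = either (unsafe⊆Σ d v ψ) (unsafe⊆Σ e w ψ)
    unsafe⊆Σ (∧E₁ d) v = unsafe⊆Σ d v
    unsafe⊆Σ (∧E₂ d) v = unsafe⊆Σ d v
    unsafe⊆Σ (∨I₁ _ d) v = unsafe⊆Σ d v
    unsafe⊆Σ (∨I₂ _ d) v = unsafe⊆Σ d v
    unsafe⊆Σ (∨E d e f) (u , v , w) ψ =
      either (unsafe⊆Σ d u ψ) (either (unsafe⊆Σ e v ψ) (unsafe⊆Σ f w ψ))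
    unsafe⊆Σ (⇒I d) v = unsafe⊆Σ d v
    unsafe⊆Σ (iTrans d e) (v , w) ψ = either (unsafe⊆Σ d v ψ) (unsafe⊆Σ e w ψ)
    unsafe⊆Σ (i∧I d e) (v , w) ψ = either (unsafe⊆Σ d v ψ) (unsafe⊆Σ e w ψ)
    unsafe⊆Σ (i∨E d e) (v , w) ψ = either (unsafe⊆Σ d v ψ) (unsafe⊆Σ e w ψ)
    unsafe⊆Σ (i∀I d) v = unsafe⊆Σ d v
    unsafe⊆Σ (i∃E d) v = unsafe⊆Σ d v
    unsafe⊆Σ (∀I _ d) (_ , _ , v) = unsafe⊆Σ d v
    unsafe⊆Σ (∀E _ d) v = unsafe⊆Σ d v
    unsafe⊆Σ (CD d) v = unsafe⊆Σ d v
    unsafe⊆Σ (∃I _ d) v = unsafe⊆Σ d v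
    unsafe⊆Σ (∃E _ d e) (_ , _ , _ , _ , v , w) ψ = either (unsafe⊆Σ d v ψ) (unsafe⊆Σ e w ψ)
    unsafe⊆Σ (MP d e) (_ , e⊆Σ , v) ψ = either (unsafe⊆Σ d v ψ) (e⊆Σ ψ)

    translate : (d : Tree Δ α) → Valid (withΣ Σs) d → Translation (Open d) (UnsafeOcc d) α
    translate (hyp φ) _ = single refl
    translate (dis x) _ = single (z≤n , refl)
    translate ⊤I _ = trivial
    translate (⊥E φ d) v = step₁ (translate d v) (⇒Iᴰ (⊥Eᴰ φ var₀))
    translate (∧I d e) (v , w) = step₂ (translate d v) (translate e w) identity
    translate (∧E₁ d) v = step₁ (translate d v) (⇒Iᴰ (∧E₁ᴰ var₀))
    translate (∧E₂ d) v = step₁ (translate d v) (⇒Iᴰ (∧E₂ᴰ var₀))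
    translate (∨I₁ ψ d) v = step₁ (translate d v) (⇒Iᴰ (∨I₁ᴰ ψ var₀))
    translate (∨I₂ φ d) v = step₁ (translate d v) (⇒Iᴰ (∨I₂ᴰ φ var₀))
    translate (∨E d e f) (u , v , w) =
      case-split (translate d u) (relabel (open-split [] e) ⊆′-refl (translate e v))
                                 (relabel (open-split [] f) ⊆′-refl (translate f w))
    translate (⇒I d) v = discharge (relabel (open-split [] d) ⊆′-refl (translate d v))
    translate (iTrans d e) (v , w) =
      step₂ (translate d v) (translate e w) (⇒Iᴰ (iTransᴰ (∧E₁ᴰ var₀) (∧E₂ᴰ var₀)))
    translate (i∧I d e) (v , w) =
      step₂ (translate d v) (translate e w) (⇒Iᴰ (i∧Iᴰ (∧E₁ᴰ var₀) (∧E₂ᴰ var₀)))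
    translate (i∨E d e) (v , w) =
      step₂ (translate d v) (translate e w) (⇒Iᴰ (i∨Eᴰ (∧E₁ᴰ var₀) (∧E₂ᴰ var₀)))
    translate (i∀I d) v = step₁ (translate d v) (⇒Iᴰ (i∀Iᴰ var₀))
    translate (i∃E d) v = step₁ (translate d v) (⇒Iᴰ (i∃Eᴰ var₀))
    translate (∀I i d) (fφ , fO , v) =
      generalize i fφ fO (λ χ → fO χ ∘ unsafe⊆open 0 d χ) (translate d v)
    translate (∀E t d) v = step₁ (translate d v) (⇒Iᴰ (∀Eᴰ t var₀))
    translate (CD d) v = step₁ (translate d v) (⇒Iᴰ (CDᴰ var₀))
    translate (∃I t d) v = step₁ (translate d v) (⇒Iᴰ (∃Iᴰ t var₀))
    translate (MP d e) (ve , _ , vd) =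
      relabel (λ _ → inj₁) ⊆′-refl (modus-ponens (translate d vd) (e , ve , ⊆′-refl))
    translate (∃E i {φ} d e) (fφ , fψ , minor , safe , vd , ve) =
      exists-elim i fφ fψ unsafe-fresh (translate d vd) (relabel sort ⊆′-refl (translate e ve))
      where
        -- by restriction (ii), φ(a_i) has no unsafe occurrence in e
        unsafe-fresh : UnsafeOcc e ⊆′ Fresh i
        unsafe-fresh χ u with minor χ (unsafe⊆open 0 e χ u)
        ... | inj₁ refl = ⊥-elim (safe u)
        ... | inj₂ fχ = fχ
        sort : Open e ⊆′ ((OA 1 e ∩ Fresh i) ∪ (_≡ φ [ par i ]))
        sort χ o with open-split [] e χ o
        ... | inj₂ eq = inj₂ eq
        ... | inj₁ o₁ with minor χ (open-antitone 0 e χ o₁)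
        ...   | inj₁ eq = inj₂ eq
        ...   | inj₂ fχ = inj₁ (o₁ , fχ)

    conclude : (Γ : List Sent) → Translation (Σs ∪ (_∈ Γ)) Σs φ → Σs ⊢ (⋀ Γ ⇒ φ)
    conclude Γ (translation M M⊆Σ∪Γ D) = iTransᴰ (⇒Iᴰ (⋀-intro M supply)) D
      where
        supply : ∀ x → x ∈ M → Der (⋀ Γ ∷ []) x Σs
        supply x m with M⊆Σ∪Γ x m
        ... | inj₁ s = loosen (λ _ eq → subst Σs (sym eq) s) assume
        ... | inj₂ m′ = ⋀-elim m′ var₀

mainTheorem9 : (L : Signature) → let open FOL L in
    (Σs : Sent → Set) (Γ : List Sent) (φ : Sent) →
    (λ χ → Σs χ ⊎ χ ∈ Γ) ⊢[ Σs ] φ → Σs ⊢ (⋀ Γ ⇒ φ)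
mainTheorem9 L Σs Γ φ (d , valid , open⊆Σ∪Γ) =
  conclude Σs Γ (relabel open⊆Σ∪Γ (unsafe⊆Σ Σs d valid) (translate Σs d valid))
  where open Deduction L
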